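{- (1) Suppose $S(n,i)\subseteq\mathbb N$, for $n\in\mathbb N$ and $i<2^n$, are finite sets with $|S(n,i)|\ge n+(4^{n+1}-1)/3$ for all $n,i$. Then there are pairwise disjoint sets $F(n,i)\subseteq S(n,i)\setminus\{0,\dots,n-1\}$ with $|F(n,i)|=2^n$ for all $n$ and $i<2^n$. (2) Suppose $D\subseteq\{0,1\}^{<\mathbb N}$ and $A(s)$, for $s\in D$, are finite subsets of $\mathbb N$ with $|A(s)|\ge|s|+(4^{|s|+1}-1)/3$ for all $s\in D$. Then there are pairwise disjoint sets $B(s)\subseteq A(s)\setminus\{0,\dots,|s|-1\}$, for $s\in D$, with $|B(s)|=2^{|s|}$ for all $s\in D$.
   Context: $\{0,1\}^{<\mathbb N}$ is the set of finite binary sequences and $|s|$ is the length of $s$. -}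

module Defs where

open import Data.Nat using (ℕ; suc; _+_; _∸_; _^_; _≤_)
open import Data.Nat.DivMod using (_/_)
open import Data.Bool using (Bool)
open import Data.Fin using (Fin; toℕ)
open import Data.List using (List; length)
open import Data.List.Membership.Propositional using (_∈_)
open import Data.List.Relation.Unary.Unique.Propositional using (Unique)
open import Data.Product using (Σ; _×_)
open import Relation.Binary.PropositionalEquality using (_≡_)

-- A finite subset of ℕ is represented by a duplicate-free list; its
-- cardinality is the length of the list.

-- The size bound  n + (4^(n+1) - 1)/3  (the division is exact).
bound : ℕ → ℕ
bound n = n + (4 ^ suc n ∸ 1) / 3

Part1 : Set
Part1 =
  (S : (n : ℕ) → Fin (2 ^ n) → List ℕ) →
  (∀ n i → Unique (S n i)) →
  (∀ n i → bound n ≤ length (S n i)) →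
  Σ ((n : ℕ) → Fin (2 ^ n) → List ℕ) λ F →
      (∀ n i → Unique (F n i))
    × (∀ n i → length (F n i) ≡ 2 ^ n)
    × (∀ n i x → x ∈ F n i → (x ∈ S n i) × (n ≤ x))
    × (∀ n i m j x → x ∈ F n i → x ∈ F m j → (n ≡ m) × (toℕ i ≡ toℕ j))

-- Part (2). D ⊆ {0,1}^{<ℕ} is a predicate on finite binary sequences
-- (lists of booleans); A(s) only matters for s ∈ D.
Part2 : Set₁
Part2 =
  (D : List Bool → Set) →
  (A : List Bool → List ℕ) →
  (∀ s → D s → Unique (A s)) →
  (∀ s → D s → bound (length s) ≤ length (A s)) →
  Σ (List Bool → List ℕ) λ B →
      (∀ s → D s → Unique (B s))
    × (∀ s → D s → length (B s) ≡ 2 ^ length s)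
    × (∀ s → D s → ∀ x → x ∈ B s → (x ∈ A s) × (length s ≤ x))
    × (∀ s t → D s → D t → ∀ x → x ∈ B s → x ∈ B t → s ≡ t)

{-# OPTIONS --safe #-}
-- Process the index pairs (n, i) in lexicographic order and give each one,
-- greedily, 2^n elements of S(n, i) that are at least n and were not handed
-- out before.  When (n, i) is reached, the earlier blocks have used at most
-- (1 + 4 + ⋯ + 4^(n-1)) + i·2^n ≤ (4^(n+1) - 1)/3 - 2^n elements, and at most
-- n further elements of S(n, i) lie below n, so the bound on |S(n, i)| leaves
-- 2^n candidates.  Part (2) is the same construction, indexing the sequences
-- of length n by the numbers below 2^n.
module Submission where

open import Defs
open import Data.Bool using (Bool; true; false)
open import Data.Empty using (⊥-elim)
open import Data.Fin using (Fin; toℕ; zero; suc)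
open import Data.Fin.Properties using (toℕ<n)
open import Data.List using (List; []; _∷_; length; _++_; filter; take; upTo)
open import Data.List.Properties using (length-++; length-take; length-upTo; length-removeAt′)
open import Data.List.Membership.Propositional using (_∈_; _∉_; _─_)
open import Data.List.Membership.Propositional.Properties using (∈-++⁺ˡ; ∈-++⁺ʳ; ∈-upTo⁺; ∈-filter⁺; ∈-filter⁻)
open import Data.List.Relation.Binary.Subset.Propositional using (_⊆_)
open import Data.List.Relation.Binary.Subset.Propositional.Properties using (⊆-refl; ⊆-trans; xs⊆xs++ys; xs⊆ys++xs)
open import Data.List.Relation.Binary.Sublist.Propositional.Properties using (take-⊆; Any-resp-⊆)
open import Data.List.Relation.Unary.All using (lookup)
open import Data.List.Relation.Unary.Any using (here; there)
open import Data.List.Relation.Unary.AllPairs using ([]; _∷_)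
open import Data.List.Relation.Unary.Unique.Propositional using (Unique)
import Data.List.Relation.Unary.Unique.Propositional.Properties as Unique
open import Data.Nat
open import Data.List.Membership.DecPropositional _≟_ using (_∈?_)
open import Data.Nat.DivMod using (m*n/n≡m)
open import Data.Nat.Properties
open import Data.Nat.Solver using (module +-*-Solver)
open import Data.Product using (_×_; _,_; proj₁; proj₂)
open import Data.Sum using (_⊎_; inj₁; inj₂)
open import Function using (_∘_)
open import Relation.Binary.Definitions using (tri<; tri≈; tri>)
open import Relation.Binary.PropositionalEquality
open import Relation.Nullary using (yes; no)
open import Relation.Nullary.Decidable using (_×-dec_; ¬?)
open import Relation.Unary using (Decidable)

open +-*-Solver using (solve; _:=_; _:+_; _:*_; con)

module _ {a} {A : Set a} where

  ∈-─ : ∀ {x z} {ys : List A} (x∈ys : x ∈ ys) → z ∈ ys → z ≢ x → z ∈ ys ─ x∈ys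
  ∈-─ (here refl) (here refl) z≢x = ⊥-elim (z≢x refl)
  ∈-─ (here _)    (there z∈ys) _  = z∈ys
  ∈-─ (there _)   (here z≡y)   _  = here z≡y
  ∈-─ (there x∈ys) (there z∈ys) z≢x = there (∈-─ x∈ys z∈ys z≢x)

  Unique-⊆⇒length≤ : ∀ {xs ys : List A} → Unique xs → xs ⊆ ys → length xs ≤ length ys
  Unique-⊆⇒length≤ {[]}     _              _  = z≤n
  Unique-⊆⇒length≤ {x ∷ xs} {ys} (x∉xs ∷ u) xs⊆ys =
    subst (suc (length xs) ≤_) (sym (length-removeAt′ ys _))
      (s≤s (Unique-⊆⇒length≤ u λ z∈xs →
        ∈-─ x∈ys (xs⊆ys (there z∈xs)) λ z≡x → lookup x∉xs z∈xs (sym z≡x)))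
    where x∈ys = xs⊆ys (here refl)

  extend : ∀ {n} → A → (Fin n → A) → ℕ → A
  extend {zero}  d f _       = d
  extend {suc n} d f zero    = f zero
  extend {suc n} d f (suc j) = extend d (f ∘ suc) j

  extend-toℕ : ∀ {n} d (f : Fin n → A) i → extend d f (toℕ i) ≡ f i
  extend-toℕ d f zero    = refl
  extend-toℕ d f (suc i) = extend-toℕ d (f ∘ suc) i

Fresh : ℕ → List ℕ → ℕ → Set
Fresh n U x = x ∉ U × n ≤ x

fresh? : ∀ n U → Decidable (Fresh n U)
fresh? n U x = ¬? (x ∈? U) ×-dec (n ≤? x)

choose : (k n : ℕ) (U L : List ℕ) → List ℕ
choose k n U L = take k (filter (fresh? n U) L)

choose-⊆ : ∀ k n U L {x} → x ∈ choose k n U L → x ∈ L × Fresh n U x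
choose-⊆ k n U L = ∈-filter⁻ (fresh? n U) ∘ Any-resp-⊆ (take-⊆ k _)

choose-unique : ∀ k n U {L} → Unique L → Unique (choose k n U L)
choose-unique k n U u = Unique.take⁺ k (Unique.filter⁺ (fresh? n U) u)

length-choose≤ : ∀ k n U L → length (choose k n U L) ≤ k
length-choose≤ k n U L = subst (_≤ k) (sym (length-take k _)) (m⊓n≤m k _)

⊆-fresh++stale : ∀ n U L → L ⊆ filter (fresh? n U) L ++ (upTo n ++ U)
⊆-fresh++stale n U L {x} x∈L with x <? n | x ∈? U
... | yes x<n | _       = ∈-++⁺ʳ (filter (fresh? n U) L) (∈-++⁺ˡ (∈-upTo⁺ x<n))
... | no _    | yes x∈U = ∈-++⁺ʳ (filter (fresh? n U) L) (∈-++⁺ʳ (upTo n) x∈U)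
... | no x≮n  | no x∉U  = ∈-++⁺ˡ (∈-filter⁺ (fresh? n U) x∈L (x∉U , ≮⇒≥ x≮n))

length-choose : ∀ k n U L → Unique L → n + length U + k ≤ length L →
                length (choose k n U L) ≡ k
length-choose k n U L u room =
  trans (length-take k _) (m≤n⇒m⊓n≡m (+-cancelʳ-≤ (n + length U) k #fresh enough))
  where
  #fresh : ℕ
  #fresh = length (filter (fresh? n U) L)
  enough : k + (n + length U) ≤ #fresh + (n + length U)
  enough = begin
    k + (n + length U)                  ≡⟨ +-comm k _ ⟩
    n + length U + k                    ≤⟨ room ⟩
    length L                            ≤⟨ Unique-⊆⇒length≤ u (⊆-fresh++stale n U L) ⟩
    length (filter (fresh? n U) L ++ (upTo n ++ U))
      ≡⟨ trans (length-++ (filter (fresh? n U) L))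
               (cong (#fresh +_) (trans (length-++ (upTo n)) (cong (_+ length U) (length-upTo n)))) ⟩
    #fresh + (n + length U)             ∎
    where open ≤-Reasoning

sum4^ : ℕ → ℕ
sum4^ zero    = 0
sum4^ (suc n) = sum4^ n + 2 ^ n * 2 ^ n

2^n*2^n≡4^n : ∀ n → 2 ^ n * 2 ^ n ≡ 4 ^ n
2^n*2^n≡4^n n = trans (sym (^-distribˡ-+-* 2 n n))
                      (trans (cong (λ m → 2 ^ (n + m)) (sym (+-identityʳ n))) (sym (^-*-assoc 2 2 n)))

sum4^-closed : ∀ n → sum4^ n * 3 + 1 ≡ 4 ^ n
sum4^-closed zero    = refl
sum4^-closed (suc n) = begin
  (sum4^ n + 2 ^ n * 2 ^ n) * 3 + 1 ≡⟨ cong (λ p → (sum4^ n + p) * 3 + 1) (2^n*2^n≡4^n n) ⟩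
  (sum4^ n + 4 ^ n) * 3 + 1         ≡⟨ solve 2 (λ g p → (g :+ p) :* con 3 :+ con 1 := (g :* con 3 :+ con 1) :+ con 3 :* p) refl (sum4^ n) (4 ^ n) ⟩
  (sum4^ n * 3 + 1) + 3 * 4 ^ n     ≡⟨ cong (_+ 3 * 4 ^ n) (sum4^-closed n) ⟩
  4 * 4 ^ n                         ∎
  where open ≡-Reasoning

bound≡ : ∀ n → bound n ≡ n + sum4^ (suc n)
bound≡ n = cong (n +_) (begin
  (4 ^ suc n ∸ 1) / 3             ≡⟨ cong (λ t → (t ∸ 1) / 3) (sym (sum4^-closed (suc n))) ⟩
  (sum4^ (suc n) * 3 + 1 ∸ 1) / 3 ≡⟨ cong (_/ 3) (m+n∸n≡m (sum4^ (suc n) * 3) 1) ⟩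
  sum4^ (suc n) * 3 / 3           ≡⟨ m*n/n≡m (sum4^ (suc n)) 3 ⟩
  sum4^ (suc n)                   ∎)
  where open ≡-Reasoning

+-*-suc : ∀ m n o → m + n * o + o ≡ m + suc n * o
+-*-suc = solve 3 (λ m n o → m :+ n :* o :+ o := m :+ (o :+ n :* o)) refl

module Greedy (L : ℕ → ℕ → List ℕ) where

  taken : ℕ → ℕ → List ℕ
  block : ℕ → ℕ → List ℕ

  block n j = choose (2 ^ n) n (taken n j) (L n j)

  taken n       (suc j) = taken n j ++ block n j
  taken zero    zero    = []
  -- Row n ends after its 2^n blocks.
  taken (suc n) zero    = taken n (2 ^ n)

  block-⊆ : ∀ n j {x} → x ∈ block n j → x ∈ L n j × Fresh n (taken n j) x
  block-⊆ n j = choose-⊆ (2 ^ n) n (taken n j) (L n j)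

  block-fresh : ∀ {n j x} → x ∈ block n j → x ∉ taken n j
  block-fresh {n} {j} = proj₁ ∘ proj₂ ∘ block-⊆ n j

  block-unique : ∀ n j → Unique (L n j) → Unique (block n j)
  block-unique n j = choose-unique (2 ^ n) n (taken n j)

  length-taken : ∀ n j → length (taken n j) ≤ sum4^ n + j * 2 ^ n
  length-taken n (suc j) = begin
    length (taken n j ++ block n j)         ≡⟨ length-++ (taken n j) ⟩
    length (taken n j) + length (block n j) ≤⟨ +-mono-≤ (length-taken n j) (length-choose≤ (2 ^ n) n (taken n j) (L n j)) ⟩
    sum4^ n + j * 2 ^ n + 2 ^ n             ≡⟨ +-*-suc (sum4^ n) j (2 ^ n) ⟩
    sum4^ n + suc j * 2 ^ n                 ∎
    where open ≤-Reasoning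
  length-taken zero    zero = z≤n
  length-taken (suc n) zero =
    subst (length (taken n (2 ^ n)) ≤_) (sym (+-identityʳ (sum4^ (suc n)))) (length-taken n (2 ^ n))

  length-taken+2^n≤ : ∀ n j → j < 2 ^ n → length (taken n j) + 2 ^ n ≤ sum4^ (suc n)
  length-taken+2^n≤ n j j<2^n = begin
    length (taken n j) + 2 ^ n  ≤⟨ +-monoˡ-≤ (2 ^ n) (length-taken n j) ⟩
    sum4^ n + j * 2 ^ n + 2 ^ n ≡⟨ +-*-suc (sum4^ n) j (2 ^ n) ⟩
    sum4^ n + suc j * 2 ^ n     ≤⟨ +-monoʳ-≤ (sum4^ n) (*-monoˡ-≤ (2 ^ n) j<2^n) ⟩
    sum4^ (suc n)               ∎
    where open ≤-Reasoning

  length-block : ∀ n j → j < 2 ^ n → Unique (L n j) → bound n ≤ length (L n j) →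
                 length (block n j) ≡ 2 ^ n
  length-block n j j<2^n u big = length-choose (2 ^ n) n (taken n j) (L n j) u (begin
    n + length (taken n j) + 2 ^ n   ≡⟨ +-assoc n _ _ ⟩
    n + (length (taken n j) + 2 ^ n) ≤⟨ +-monoʳ-≤ n (length-taken+2^n≤ n j j<2^n) ⟩
    n + sum4^ (suc n)                ≡⟨ sym (bound≡ n) ⟩
    bound n                          ≤⟨ big ⟩
    length (L n j)                   ∎)
    where open ≤-Reasoning

  taken-monoʳ : ∀ n {j k} → j ≤ k → taken n j ⊆ taken n k
  taken-monoʳ n {k = zero}  z≤n  = ⊆-refl
  taken-monoʳ n {k = suc k} j≤1+k with m≤n⇒m<n∨m≡n j≤1+k
  ... | inj₁ j<1+k = ⊆-trans (taken-monoʳ n (s≤s⁻¹ j<1+k)) (xs⊆xs++ys (taken n k) (block n k))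
  ... | inj₂ refl  = ⊆-refl

  taken-monoˡ : ∀ {n m j} k → n < m → j ≤ 2 ^ n → taken n j ⊆ taken m k
  taken-monoˡ {n} {suc m} {j} k (s≤s n≤m) j≤2^n =
    ⊆-trans earlier (taken-monoʳ (suc m) {k = k} z≤n)
    where
    earlier : taken n j ⊆ taken m (2 ^ m)
    earlier with m≤n⇒m<n∨m≡n n≤m
    ... | inj₁ n<m = taken-monoˡ (2 ^ m) n<m j≤2^n
    ... | inj₂ refl = taken-monoʳ n j≤2^n

  block⊆taken : ∀ {n j} m k → j < 2 ^ n → n < m ⊎ (n ≡ m × j < k) → block n j ⊆ taken m k
  block⊆taken {n} {j} m k j<2^n (inj₁ n<m) =
    ⊆-trans (xs⊆ys++xs (block n j) (taken n j)) (taken-monoˡ k n<m j<2^n)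
  block⊆taken {n} {j} m k _ (inj₂ (refl , j<k)) =
    ⊆-trans (xs⊆ys++xs (block n j) (taken n j)) (taken-monoʳ n j<k)

  blocks-disjoint : ∀ {n j m k x} → j < 2 ^ n → k < 2 ^ m →
                    x ∈ block n j → x ∈ block m k → n ≡ m × j ≡ k
  blocks-disjoint {n} {j} {m} {k} j<2^n k<2^m x∈nj x∈mk with <-cmp n m | <-cmp j k
  ... | tri< n<m _ _ | _ = ⊥-elim (block-fresh x∈mk (block⊆taken m k j<2^n (inj₁ n<m) x∈nj))
  ... | tri> _ _ m<n | _ = ⊥-elim (block-fresh x∈nj (block⊆taken n j k<2^m (inj₁ m<n) x∈mk))
  ... | tri≈ _ refl _ | tri< j<k _ _ = ⊥-elim (block-fresh x∈mk (block⊆taken m k j<2^n (inj₂ (refl , j<k)) x∈nj))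
  ... | tri≈ _ refl _ | tri> _ _ k<j = ⊥-elim (block-fresh x∈nj (block⊆taken n j k<2^m (inj₂ (refl , k<j)) x∈mk))
  ... | tri≈ _ refl _ | tri≈ _ refl _ = refl , refl

part1 : Part1
part1 S S-unique S-big = F , F-unique , F-length , F-⊆ , F-disjoint
  where
  open Greedy (λ n → extend [] (S n))
  L≡S : ∀ n i → extend [] (S n) (toℕ i) ≡ S n i
  L≡S n = extend-toℕ [] (S n)
  L-unique : ∀ n i → Unique (extend [] (S n) (toℕ i))
  L-unique n i = subst Unique (sym (L≡S n i)) (S-unique n i)

  F : (n : ℕ) → Fin (2 ^ n) → List ℕ
  F n i = block n (toℕ i)
  F-unique : ∀ n i → Unique (F n i)
  F-unique n i = block-unique n (toℕ i) (L-unique n i)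
  F-length : ∀ n i → length (F n i) ≡ 2 ^ n
  F-length n i = length-block n (toℕ i) (toℕ<n i) (L-unique n i)
                   (subst (λ L → bound n ≤ length L) (sym (L≡S n i)) (S-big n i))
  F-⊆ : ∀ n i x → x ∈ F n i → (x ∈ S n i) × (n ≤ x)
  F-⊆ n i x x∈F with block-⊆ n (toℕ i) x∈F
  ... | x∈L , _ , n≤x = subst (x ∈_) (L≡S n i) x∈L , n≤x
  F-disjoint : ∀ n i m j x → x ∈ F n i → x ∈ F m j → (n ≡ m) × (toℕ i ≡ toℕ j)
  F-disjoint n i m j x = blocks-disjoint (toℕ<n i) (toℕ<n j)

fromSeq : List Bool → ℕ
fromSeq []          = 0
fromSeq (false ∷ s) = fromSeq s
fromSeq (true ∷ s)  = 2 ^ length s + fromSeq s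

toSeq : ℕ → ℕ → List Bool
toSeq zero    j = []
toSeq (suc n) j with j <? 2 ^ n
... | yes _ = false ∷ toSeq n j
... | no _  = true ∷ toSeq n (j ∸ 2 ^ n)

fromSeq< : ∀ s → fromSeq s < 2 ^ length s
fromSeq< []          = s≤s z≤n
fromSeq< (false ∷ s) = <-≤-trans (fromSeq< s) (m≤m+n (2 ^ length s) _)
fromSeq< (true ∷ s)  = +-monoʳ-< (2 ^ length s) (subst (fromSeq s <_) (sym (+-identityʳ _)) (fromSeq< s))

toSeq-fromSeq : ∀ s → toSeq (length s) (fromSeq s) ≡ s
toSeq-fromSeq []          = refl
toSeq-fromSeq (false ∷ s) with fromSeq s <? 2 ^ length s
... | yes _ = cong (false ∷_) (toSeq-fromSeq s)
... | no ≮  = ⊥-elim (≮ (fromSeq< s))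
toSeq-fromSeq (true ∷ s) with 2 ^ length s + fromSeq s <? 2 ^ length s
... | yes < = ⊥-elim (m+n≮m _ _ <)
... | no _  = cong (true ∷_) (trans (cong (toSeq (length s)) (m+n∸m≡n (2 ^ length s) (fromSeq s)))
                                    (toSeq-fromSeq s))

fromSeq-injective : ∀ s t → length s ≡ length t → fromSeq s ≡ fromSeq t → s ≡ t
fromSeq-injective s t |s|≡|t| eq = begin
  s                               ≡⟨ sym (toSeq-fromSeq s) ⟩
  toSeq (length s) (fromSeq s)    ≡⟨ cong₂ toSeq |s|≡|t| eq ⟩
  toSeq (length t) (fromSeq t)    ≡⟨ toSeq-fromSeq t ⟩
  t                               ∎
  where open ≡-Reasoning

part2 : Part2
part2 D A A-unique A-big = B , B-unique , B-length , B-⊆ , B-disjoint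
  where
  open Greedy (λ n j → A (toSeq n j))
  L≡A : ∀ s → A (toSeq (length s) (fromSeq s)) ≡ A s
  L≡A s = cong A (toSeq-fromSeq s)
  L-unique : ∀ s → D s → Unique (A (toSeq (length s) (fromSeq s)))
  L-unique s d = subst Unique (sym (L≡A s)) (A-unique s d)

  B : List Bool → List ℕ
  B s = block (length s) (fromSeq s)
  B-unique : ∀ s → D s → Unique (B s)
  B-unique s d = block-unique (length s) (fromSeq s) (L-unique s d)
  B-length : ∀ s → D s → length (B s) ≡ 2 ^ length s
  B-length s d = length-block (length s) (fromSeq s) (fromSeq< s) (L-unique s d)
                   (subst (λ L → bound (length s) ≤ length L) (sym (L≡A s)) (A-big s d))
  B-⊆ : ∀ s → D s → ∀ x → x ∈ B s → (x ∈ A s) × (length s ≤ x)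
  B-⊆ s _ x x∈B with block-⊆ (length s) (fromSeq s) x∈B
  ... | x∈L , _ , n≤x = subst (x ∈_) (L≡A s) x∈L , n≤x
  B-disjoint : ∀ s t → D s → D t → ∀ x → x ∈ B s → x ∈ B t → s ≡ t
  B-disjoint s t _ _ x x∈Bs x∈Bt with blocks-disjoint (fromSeq< s) (fromSeq< t) x∈Bs x∈Bt
  ... | |s|≡|t| , eq = fromSeq-injective s t |s|≡|t| eq

lemma3p8 : Part1 × Part2
lemma3p8 = part1 , part2
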